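{- In $\mathrm{Sym}^{(2)}$, for all integers $n,k,r\ge 0$, $$\tilde B^{r}_{n+k+r,k+r}=\binom{n+k}{n}^{ -1}B^{r}_{n+k+r,k+r}(a_1,a_2,\dots;b_1,2b_2,3b_3,\dots),$$ equivalently $\exp(a_1y)\exp(xtb_1)\exp(x\partial)=\exp\big(\sum_{j\ge0}a_{j+1}\frac{x^j}{j!}y\big)\exp\big(\sum_{j\ge1}jb_j\frac{x^jt}{j!}\big)$. In particular, for $r=0$, $$\tilde B^{0}_{n+k,k}=B^{k}_{n+k,k}(b_1,b_2,\dots;b_1,b_2,\dots)=\binom{n+k}{n}^{ -1}B_{n+k,k}(b_1,2b_2,3b_3,\dots).$$
   Context: $\mathrm{Sym}^{(2)}$ is the free commutative $\mathbb C$-algebra on $a_1,a_2,\dots,b_1,b_2,\dots$; $\partial$ is the unique derivation with $a_i\partial=a_{i+1}$, $b_i\partial=b_{i+1}$ (operators written on the right; an element used as an operator means multiplication by it). $\tilde B^r_{n+k+r,k+r}=a_1^rb_1^k\partial^n$ (i.e. $\partial$ applied $n$ times to $a_1^rb_1^k$). $B^r_{n+r,k+r}(a_1,a_2,\dots;b_1,b_2,\dots)$ is the coefficient of $t^k$ in $a_1^r(tb_1+\partial)^n$; it equals the partial $r$-Bell polynomial, i.e. $\sum_{n,r,k}B^r_{n+r,k+r}\frac{x^n}{n!}\frac{y^r}{r!}t^k=\exp\big(\sum_{j\ge0}a_{j+1}\frac{x^j}{j!}y\big)\exp\big(\sum_{j\ge1}b_j\frac{x^jt}{j!}\big)$, and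 $B^r_{n+r,k+r}(a_1,a_2,\dots;c_1,c_2,\dots)$ denotes the same polynomial with $b_j$ replaced by $c_j$. $B_{n,k}=B^0_{n,k}$ is the ordinary partial Bell polynomial, $\sum_{n}B_{n,k}(c_1,c_2,\dots)\frac{x^n}{n!}t^k$ summed over $n,k$ being $\exp(\sum_m c_m\frac{x^m}{m!}t)$. -}

module Defs where

open import Level using (0ℓ)
open import Data.Nat using (ℕ; zero; suc)
open import Algebra.Bundles using (CommutativeRing)

-- Elements of Sym^(2): polynomial expressions in the free commutative
-- algebra on a_1,a_2,... and b_1,b_2,...
--   A i  denotes the variable a_{i+1}
--   B i  denotes the variable b_{i+1}
--   lit m denotes the scalar m (all scalars needed are natural numbers)

infixl 6 _⊕_
infixl 7 _⊗_

data Expr : Set where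
  A B  : ℕ → Expr
  lit  : ℕ → Expr
  _⊕_  : Expr → Expr → Expr
  _⊗_  : Expr → Expr → Expr

module _ (R : CommutativeRing 0ℓ 0ℓ) where
  open CommutativeRing R

  natR : ℕ → Carrier
  natR zero    = 0#
  natR (suc m) = 1# + natR m

  eval : (ℕ → Carrier) → (ℕ → Carrier) → Expr → Carrier
  eval α β (A i)   = α i
  eval α β (B i)   = β i
  eval α β (lit m) = natR m
  eval α β (x ⊕ y) = eval α β x + eval α β y
  eval α β (x ⊗ y) = eval α β x * eval α β y

-- Equality in the free commutative algebra: two expressions are equal
-- iff they agree under every evaluation in every commutative ring
-- (universal property of the free commutative algebra).
infix 4 _≐_
_≐_ : Expr → Expr → Set₁
x ≐ y = (R : CommutativeRing 0ℓ 0ℓ) (α β : ℕ → CommutativeRing.Carrier R) →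
        CommutativeRing._≈_ R (eval R α β x) (eval R α β y)

pow : Expr → ℕ → Expr
pow x zero    = lit 1
pow x (suc m) = pow x m ⊗ x

iter : {X : Set} → ℕ → (X → X) → X → X
iter zero    f x = x
iter (suc m) f x = f (iter m f x)

∂ : Expr → Expr
∂ (A i)   = A (suc i)
∂ (B i)   = B (suc i)
∂ (lit m) = lit 0
∂ (x ⊕ y) = ∂ x ⊕ ∂ y
∂ (x ⊗ y) = ∂ x ⊗ y ⊕ x ⊗ ∂ y

subst : (ℕ → Expr) → (ℕ → Expr) → Expr → Expr
subst σ τ (A i)   = σ i
subst σ τ (B i)   = τ i
subst σ τ (lit m) = lit m
subst σ τ (x ⊕ y) = subst σ τ x ⊕ subst σ τ y
subst σ τ (x ⊗ y) = subst σ τ x ⊗ subst σ τ y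

a₁ b₁ : Expr
a₁ = A 0
b₁ = B 0

-- B̃^r_{n+k+r,k+r} = a_1^r b_1^k ∂^n
B̃ : (r n k : ℕ) → Expr
B̃ r n k = iter n ∂ (pow a₁ r ⊗ pow b₁ k)

-- Polynomials in t with coefficients in Sym^(2), as coefficient functions.
TPoly : Set
TPoly = ℕ → Expr

-- The operator (t b_1 + ∂) acting (on the right) on a t-polynomial;
-- t is a scalar variable with t∂ = 0.
step : TPoly → TPoly
step f zero    = ∂ (f zero)
step f (suc k) = b₁ ⊗ f k ⊕ ∂ (f (suc k))

a₁^ : ℕ → TPoly
a₁^ r zero    = pow a₁ r
a₁^ r (suc k) = lit 0

-- Bell r n k = B^r_{n+r,k+r}(a_1,a_2,...;b_1,b_2,...):
-- coefficient of t^k in a_1^r (t b_1 + ∂)^n.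
Bell : (r n k : ℕ) → Expr
Bell r n k = iter n step (a₁^ r) k

aVar bVar jbVar : ℕ → Expr
aVar i  = A i
bVar i  = B i
jbVar i = lit (suc i) ⊗ B i

-- Both sides are expanded by Leibniz rules.  The operator t b₁ + ∂ satisfies
-- (x f)(t b₁ + ∂) = (x∂) f + x (f (t b₁ + ∂)), so B^r_{m+r,k+r} = Σ_{i+j=m} C(m,i) (a₁^r ∂^i) B_{j,k},
-- while (a₁^r b₁^k) ∂^n = Σ_{i+j=n} C(n,i) (a₁^r ∂^i) (b₁^k ∂^j).  With the trinomial identity
-- C(i+j+k,i) C(j+k,k) = C(i+j+k,k) C(i+j,i) the theorem reduces to the case r = 0,
-- C(n+k,k) b₁^k ∂^n = B_{n+k,k}(b₁,2b₂,…), which is an induction on k through the recurrence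
-- B_{m+1,k+1} = Σ_{i+j=m} C(m,i) b_{i+1} B_{m-i,k}: the weight i+1 of b_{i+1} splits the sum into
-- b₁^{k+1} ∂^n and n (b₂ b₁^k) ∂^{n-1} = n/(k+1) b₁^{k+1} ∂^n, and C(n+k,k) (1 + n/(k+1)) = C(n+k+1,k+1).

module Submission where

open import Defs
open import Level using (0ℓ) renaming (suc to lsuc)
open import Algebra.Bundles using (CommutativeRing; CommutativeSemiring; AbelianGroup)
open import Algebra.Structures using (IsCommutativeSemiring; IsCommutativeRing)
import Algebra.Construct.DirectProduct as DirectProduct
import Algebra.Properties.Semiring.Mult as SemiringMult
open import Data.Nat using (ℕ; zero; suc; _+_; _*_; _<_; s≤s; z≤n; _!)
open import Data.Nat.Combinatorics using (_C_; nCn≡1; nCk+nC[k+1]≡[n+1]C[k+1])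
import Data.Nat.Properties as ℕ
open import Data.Nat.Properties using (_!≢0; _!*_!≢0)
open import Data.Nat.Tactic.RingSolver using (solve-∀)
open import Data.Product using (_×_; _,_; proj₁; proj₂)
open import Function using (_∘_)
open import Relation.Binary.PropositionalEquality as ≡ using (_≡_; cong; cong₂)

-- Binomial coefficients

binom : ℕ → ℕ → ℕ
binom zero    j       = 1
binom (suc i) zero    = 1
binom (suc i) (suc j) = binom i (suc j) + binom (suc i) j

binom-0ʳ : ∀ i → binom i 0 ≡ 1
binom-0ʳ zero    = ≡.refl
binom-0ʳ (suc i) = ≡.refl

binom≡C : ∀ n k → binom n k ≡ (n + k) C n
binom≡C zero    k       = ≡.refl
binom≡C (suc n) zero    = ≡.sym (≡.trans (cong (_C suc n) (ℕ.+-identityʳ (suc n))) (nCn≡1 (suc n)))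
binom≡C (suc n) (suc k) = begin
  binom n (suc k) + binom (suc n) k             ≡⟨ cong₂ _+_ (binom≡C n (suc k)) (binom≡C (suc n) k) ⟩
  (n + suc k) C n + (suc n + k) C suc n         ≡⟨ cong (λ m → (n + suc k) C n + m C suc n) (≡.sym (ℕ.+-suc n k)) ⟩
  (n + suc k) C n + (n + suc k) C suc n         ≡⟨ nCk+nC[k+1]≡[n+1]C[k+1] (n + suc k) n ⟩
  (suc n + suc k) C suc n                       ∎
  where open ≡.≡-Reasoning

binom-! : ∀ a b → binom a b * (a ! * b !) ≡ (a + b) !
binom-! zero    b       = ≡.trans (ℕ.*-identityˡ (1 * b !)) (ℕ.*-identityˡ (b !))
binom-! (suc a) zero    = ≡.trans (ℕ.*-identityˡ _) (≡.trans (ℕ.*-identityʳ _) (cong _! (≡.sym (ℕ.+-identityʳ (suc a)))))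
binom-! (suc a) (suc b) = begin
  (X + Y) * (suc a ! * suc b !)                                  ≡⟨ distribute a b X Y (a !) (b !) ⟩
  suc a * (X * (a ! * suc b !)) + suc b * (Y * (suc a ! * b !))  ≡⟨ cong₂ (λ u v → suc a * u + suc b * v) (binom-! a (suc b)) (binom-! (suc a) b) ⟩
  suc a * (a + suc b) ! + suc b * (suc a + b) !                  ≡⟨ cong (λ m → suc a * (a + suc b) ! + suc b * m !) (≡.sym (ℕ.+-suc a b)) ⟩
  suc a * (a + suc b) ! + suc b * (a + suc b) !                  ≡⟨ ℕ.*-distribʳ-+ ((a + suc b) !) (suc a) (suc b) ⟨
  (suc a + suc b) !                                              ∎
  where
  open ≡.≡-Reasoning
  X = binom a (suc b)
  Y = binom (suc a) b
  distribute : ∀ a b x y p q → (x + y) * (suc a * p * (suc b * q))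
                              ≡ suc a * (x * (p * (suc b * q))) + suc b * (y * (suc a * p * q))
  distribute = solve-∀

!*!-cancelʳ : ∀ a b {m n} → m * (a ! * b !) ≡ n * (a ! * b !) → m ≡ n
!*!-cancelʳ a b = ℕ.*-cancelʳ-≡ _ _ _ {{a !* b !≢0}}

binom-absorbˡ : ∀ a b → suc a * binom (suc a) b ≡ suc (a + b) * binom a b
binom-absorbˡ a b = !*!-cancelʳ a b (begin
  suc a * binom (suc a) b * (a ! * b !)      ≡⟨ rearrange a (binom (suc a) b) (a !) (b !) ⟩
  binom (suc a) b * (suc a ! * b !)          ≡⟨ binom-! (suc a) b ⟩
  suc (a + b) * (a + b) !                    ≡⟨ cong (suc (a + b) *_) (binom-! a b) ⟨
  suc (a + b) * (binom a b * (a ! * b !))    ≡⟨ ℕ.*-assoc (suc (a + b)) (binom a b) (a ! * b !) ⟨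
  suc (a + b) * binom a b * (a ! * b !)      ∎)
  where
  open ≡.≡-Reasoning
  rearrange : ∀ a y p q → suc a * y * (p * q) ≡ y * (suc a * p * q)
  rearrange = solve-∀

binom-absorbʳ : ∀ a b → suc b * binom a (suc b) ≡ suc (a + b) * binom a b
binom-absorbʳ a b = !*!-cancelʳ a b (begin
  suc b * binom a (suc b) * (a ! * b !)      ≡⟨ rearrange b (binom a (suc b)) (a !) (b !) ⟩
  binom a (suc b) * (a ! * suc b !)          ≡⟨ binom-! a (suc b) ⟩
  (a + suc b) !                              ≡⟨ cong _! (ℕ.+-suc a b) ⟩
  suc (a + b) * (a + b) !                    ≡⟨ cong (suc (a + b) *_) (binom-! a b) ⟨
  suc (a + b) * (binom a b * (a ! * b !))    ≡⟨ ℕ.*-assoc (suc (a + b)) (binom a b) (a ! * b !) ⟨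
  suc (a + b) * binom a b * (a ! * b !)      ∎)
  where
  open ≡.≡-Reasoning
  rearrange : ∀ b y p q → suc b * y * (p * q) ≡ y * (p * (suc b * q))
  rearrange = solve-∀

binom-trinomial : ∀ i j k → binom i (j + k) * binom j k ≡ binom (i + j) k * binom i j
binom-trinomial i j k = ℕ.*-cancelʳ-≡ _ _ (i ! * j ! * k !) {{ℕ.m*n≢0 (i ! * j !) (k !) {{i !* j !≢0}} {{k !≢0}}}} (begin
  binom i (j + k) * binom j k * (i ! * j ! * k !)      ≡⟨ rearrange₁ (binom i (j + k)) (binom j k) (i !) (j !) (k !) ⟩
  binom i (j + k) * (i ! * (binom j k * (j ! * k !)))  ≡⟨ cong (λ m → binom i (j + k) * (i ! * m)) (binom-! j k) ⟩
  binom i (j + k) * (i ! * (j + k) !)                  ≡⟨ binom-! i (j + k) ⟩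
  (i + (j + k)) !                                      ≡⟨ cong _! (ℕ.+-assoc i j k) ⟨
  (i + j + k) !                                        ≡⟨ binom-! (i + j) k ⟨
  binom (i + j) k * ((i + j) ! * k !)                  ≡⟨ cong (λ m → binom (i + j) k * (m * k !)) (binom-! i j) ⟨
  binom (i + j) k * (binom i j * (i ! * j !) * k !)    ≡⟨ rearrange₂ (binom (i + j) k) (binom i j) (i !) (j !) (k !) ⟩
  binom (i + j) k * binom i j * (i ! * j ! * k !)      ∎)
  where
  open ≡.≡-Reasoning
  rearrange₁ : ∀ x y p q r → x * y * (p * q * r) ≡ x * (p * (y * (q * r)))
  rearrange₁ = solve-∀
  rearrange₂ : ∀ x y p q r → x * (y * (p * q) * r) ≡ x * y * (p * q * r)
  rearrange₂ = solve-∀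

-- Sym^(2) as a commutative semiring

-- A record, so that both sides can be inferred from an equation (_≐_ unfolds to a Π-type).
infix 4 _≃_
record _≃_ (x y : Expr) : Set₁ where
  constructor mk
  field run : x ≐ y
open _≃_

private module CR = CommutativeRing

≃-isCommutativeSemiring : IsCommutativeSemiring _≃_ _⊕_ _⊗_ (lit 0) (lit 1)
≃-isCommutativeSemiring = record
  { isSemiring = record
    { isSemiringWithoutAnnihilatingZero = record
      { +-isCommutativeMonoid = record
        { isMonoid = record
          { isSemigroup = record
            { isMagma = record
              { isEquivalence = record
                { refl  = mk λ R α β → CR.refl R
                ; sym   = λ p → mk λ R α β → CR.sym R (run p R α β)
                ; trans = λ p q → mk λ R α β → CR.trans R (run p R α β) (run q R α β)
                }
              ; ∙-cong = λ p q → mk λ R α β → CR.+-cong R (run p R α β) (run q R α β)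
              }
            ; assoc = λ x y z → mk λ R α β → CR.+-assoc R _ _ _
            }
          ; identity = (λ x → mk λ R α β → CR.+-identityˡ R _)
                     , (λ x → mk λ R α β → CR.+-identityʳ R _)
          }
        ; comm = λ x y → mk λ R α β → CR.+-comm R _ _
        }
      ; *-cong = λ p q → mk λ R α β → CR.*-cong R (run p R α β) (run q R α β)
      ; *-assoc = λ x y z → mk λ R α β → CR.*-assoc R _ _ _
      ; *-identity = (λ x → mk λ R α β → CR.trans R (CR.*-congʳ R (CR.+-identityʳ R _)) (CR.*-identityˡ R _))
                   , (λ x → mk λ R α β → CR.trans R (CR.*-congˡ R (CR.+-identityʳ R _)) (CR.*-identityʳ R _))
      ; distrib = (λ x y z → mk λ R α β → CR.distribˡ R _ _ _)
                , (λ x y z → mk λ R α β → CR.distribʳ R _ _ _)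
      }
    ; zero = (λ x → mk λ R α β → CR.zeroˡ R _) , (λ x → mk λ R α β → CR.zeroʳ R _)
    }
  ; *-comm = λ x y → mk λ R α β → CR.*-comm R _ _
  }

Expr-commutativeSemiring : CommutativeSemiring 0ℓ (lsuc 0ℓ)
Expr-commutativeSemiring = record { isCommutativeSemiring = ≃-isCommutativeSemiring }

module _ (R : CommutativeRing 0ℓ 0ℓ) where
  open CommutativeRing R using (_≈_; 1#; semiring) renaming (_+_ to _+ᴿ_; _*_ to _*ᴿ_)
  open SemiringMult semiring using (×-homo-+; ×1-homo-*) renaming (_×_ to _×ₙ_)

  natR≡×1# : ∀ m → natR R m ≡ m ×ₙ 1#
  natR≡×1# zero    = ≡.refl
  natR≡×1# (suc m) = cong (1# +ᴿ_) (natR≡×1# m)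

  natR-+ : ∀ m n → natR R (m + n) ≈ natR R m +ᴿ natR R n
  natR-+ m n rewrite natR≡×1# (m + n) | natR≡×1# m | natR≡×1# n = ×-homo-+ 1# m n

  natR-* : ∀ m n → natR R (m * n) ≈ natR R m *ᴿ natR R n
  natR-* m n rewrite natR≡×1# (m * n) | natR≡×1# m | natR≡×1# n = ×1-homo-* m n

lit-+ : ∀ m n → lit (m + n) ≃ lit m ⊕ lit n
lit-+ m n = mk λ R α β → natR-+ R m n

lit-* : ∀ m n → lit (m * n) ≃ lit m ⊗ lit n
lit-* m n = mk λ R α β → natR-* R m n

-- Evaluating in the dual numbers R[ε]/(ε²), with each variable v ↦ v + (v∂)ε,
-- computes x + (x∂)ε; this is what makes ∂ well defined on the free algebra.
module DualNumbers (R : CommutativeRing 0ℓ 0ℓ) where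
  open CommutativeRing R renaming (_+_ to _+ᴿ_; _*_ to _*ᴿ_)
  open import Algebra.Solver.Ring.NaturalCoefficients.Default commutativeSemiring

  +-dualGroup : AbelianGroup 0ℓ 0ℓ
  +-dualGroup = DirectProduct.abelianGroup +-abelianGroup +-abelianGroup

  _*ᴰ_ : Carrier × Carrier → Carrier × Carrier → Carrier × Carrier
  (a , b) *ᴰ (c , d) = a *ᴿ c , a *ᴿ d +ᴿ b *ᴿ c

  open AbelianGroup +-dualGroup using () renaming (_≈_ to _≈ᴰ_)

  dual-isCommutativeRing : IsCommutativeRing _≈ᴰ_ (AbelianGroup._∙_ +-dualGroup) _*ᴰ_
                             (AbelianGroup._⁻¹ +-dualGroup) (0# , 0#) (1# , 0#)
  dual-isCommutativeRing = record
    { isRing = record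
      { +-isAbelianGroup = AbelianGroup.isAbelianGroup +-dualGroup
      ; *-cong = λ (p , q) (r , s) → *-cong p r , +-cong (*-cong p s) (*-cong q r)
      ; *-assoc = λ (a , b) (c , d) (e , f) →
          *-assoc a c e ,
          solve 6 (λ a b c d e f → (a :* c) :* f :+ (a :* d :+ b :* c) :* e
                                 := a :* (c :* f :+ d :* e) :+ b :* (c :* e)) refl a b c d e f
      ; *-identity = (λ (c , d) → *-identityˡ c ,
                       solve 2 (λ c d → con 1 :* d :+ con 0 :* c := d) refl c d)
                   , (λ (c , d) → *-identityʳ c ,
                       solve 2 (λ c d → c :* con 0 :+ d :* con 1 := d) refl c d)
      ; distrib = (λ (a , b) (c , d) (e , f) → distribˡ a c e ,
                     solve 6 (λ a b c d e f → a :* (d :+ f) :+ b :* (c :+ e)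
                                            := (a :* d :+ b :* c) :+ (a :* f :+ b :* e)) refl a b c d e f)
                , (λ (a , b) (c , d) (e , f) → distribʳ a c e ,
                     solve 6 (λ a b c d e f → (c :+ e) :* b :+ (d :+ f) :* a
                                            := (c :* b :+ d :* a) :+ (e :* b :+ f :* a)) refl a b c d e f)
      }
    ; *-comm = λ (a , b) (c , d) → *-comm a c ,
        solve 4 (λ a b c d → a :* d :+ b :* c := c :* b :+ d :* a) refl a b c d
    }

  dualNumbers : CommutativeRing 0ℓ 0ℓ
  dualNumbers = record { isCommutativeRing = dual-isCommutativeRing }

  withDerivative : (ℕ → Carrier) → ℕ → Carrier × Carrier
  withDerivative α i = α i , α (suc i)

  natR-dual : ∀ m → natR dualNumbers m ≈ᴰ (natR R m , 0#)
  natR-dual zero    = refl , refl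
  natR-dual (suc m) = +-cong refl (proj₁ (natR-dual m)) , trans (+-cong refl (proj₂ (natR-dual m))) (+-identityʳ 0#)

  eval-dual : ∀ α β x → eval dualNumbers (withDerivative α) (withDerivative β) x
                          ≈ᴰ (eval R α β x , eval R α β (∂ x))
  eval-dual α β (A i)   = refl , refl
  eval-dual α β (B i)   = refl , refl
  eval-dual α β (lit m) = natR-dual m
  eval-dual α β (x ⊕ y) with eval-dual α β x | eval-dual α β y
  ... | p₁ , p₂ | q₁ , q₂ = +-cong p₁ q₁ , +-cong p₂ q₂
  eval-dual α β (x ⊗ y) with eval-dual α β x | eval-dual α β y
  ... | p₁ , p₂ | q₁ , q₂ = *-cong p₁ q₁ , trans (+-cong (*-cong p₁ q₂) (*-cong p₂ q₁)) (+-comm _ _)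

∂-cong : ∀ {x y} → x ≃ y → ∂ x ≃ ∂ y
∂-cong {x} {y} x≃y = mk λ R α β → let open DualNumbers R in
  CR.trans R (CR.sym R (proj₂ (eval-dual α β x)))
    (CR.trans R (proj₂ (run x≃y dualNumbers (withDerivative α) (withDerivative β))) (proj₂ (eval-dual α β y)))

subst-eval : ∀ σ τ x (R : CommutativeRing 0ℓ 0ℓ) α β →
             eval R α β (subst σ τ x) ≡ eval R (eval R α β ∘ σ) (eval R α β ∘ τ) x
subst-eval σ τ (A i)   R α β = ≡.refl
subst-eval σ τ (B i)   R α β = ≡.refl
subst-eval σ τ (lit m) R α β = ≡.refl
subst-eval σ τ (x ⊕ y) R α β = cong₂ (CR._+_ R) (subst-eval σ τ x R α β) (subst-eval σ τ y R α β)
subst-eval σ τ (x ⊗ y) R α β = cong₂ (CR._*_ R) (subst-eval σ τ x R α β) (subst-eval σ τ y R α β)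

subst-cong : ∀ σ τ {x y} → x ≃ y → subst σ τ x ≃ subst σ τ y
subst-cong σ τ {x} {y} x≃y = mk λ R α β →
  CR.trans R (CR.reflexive R (subst-eval σ τ x R α β))
    (CR.trans R (run x≃y R _ _) (CR.reflexive R (≡.sym (subst-eval σ τ y R α β))))

open CommutativeSemiring Expr-commutativeSemiring
  using (setoid; reflexive; +-commutativeSemigroup; zeroˡ; zeroʳ; distribˡ; distribʳ)
  renaming ( refl to ≃-refl; sym to ≃-sym; trans to ≃-trans; +-assoc to ⊕-assoc; +-cong to ⊕-cong
           ; *-congˡ to ⊗-congˡ; *-assoc to ⊗-assoc; *-comm to ⊗-comm
           ; *-identityˡ to ⊗-identityˡ; *-identityʳ to ⊗-identityʳ; *-congʳ to ⊗-congʳ; +-identityˡ to ⊕-identityˡ; +-identityʳ to ⊕-identityʳ)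
open import Algebra.Properties.CommutativeSemigroup +-commutativeSemigroup using (interchange)
open import Algebra.Solver.Ring.NaturalCoefficients.Default Expr-commutativeSemiring
  using (solve; _:=_; _:+_; _:*_)
open import Relation.Binary.Reasoning.Setoid setoid

lit-suc-⊗ : ∀ m x → lit (suc m) ⊗ x ≃ x ⊕ lit m ⊗ x
lit-suc-⊗ m x = begin
  lit (1 + m) ⊗ x         ≈⟨ ⊗-congʳ (lit-+ 1 m) ⟩
  (lit 1 ⊕ lit m) ⊗ x     ≈⟨ distribʳ x (lit 1) (lit m) ⟩
  lit 1 ⊗ x ⊕ lit m ⊗ x   ≈⟨ ⊕-cong (⊗-identityˡ x) ≃-refl ⟩
  x ⊕ lit m ⊗ x           ∎

rescale : ∀ {a b c d} x → a * b ≡ c * d → lit a ⊗ (lit b ⊗ x) ≃ lit c ⊗ (lit d ⊗ x)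
rescale {a} {b} {c} {d} x ab≡cd = begin
  lit a ⊗ (lit b ⊗ x)   ≈⟨ ⊗-assoc _ _ _ ⟨
  lit a ⊗ lit b ⊗ x     ≈⟨ ⊗-congʳ (lit-* a b) ⟨
  lit (a * b) ⊗ x       ≡⟨ cong (λ m → lit m ⊗ x) ab≡cd ⟩
  lit (c * d) ⊗ x       ≈⟨ ⊗-congʳ (lit-* c d) ⟩
  lit c ⊗ lit d ⊗ x     ≈⟨ ⊗-assoc _ _ _ ⟩
  lit c ⊗ (lit d ⊗ x)   ∎

-- Sums over antidiagonals

antidiag : ℕ → (ℕ → ℕ → Expr) → Expr
antidiag zero    g = g 0 0
antidiag (suc m) g = g 0 (suc m) ⊕ antidiag m (λ i j → g (suc i) j)

antidiag-cong : ∀ m {g h} → (∀ i j → i + j ≡ m → g i j ≃ h i j) → antidiag m g ≃ antidiag m h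
antidiag-cong zero    g≃h = g≃h 0 0 ≡.refl
antidiag-cong (suc m) g≃h = ⊕-cong (g≃h 0 (suc m) ≡.refl) (antidiag-cong m λ i j e → g≃h (suc i) j (cong suc e))

antidiag-⊕ : ∀ m g h → antidiag m (λ i j → g i j ⊕ h i j) ≃ antidiag m g ⊕ antidiag m h
antidiag-⊕ zero    g h = ≃-refl
antidiag-⊕ (suc m) g h = ≃-trans (⊕-cong ≃-refl (antidiag-⊕ m _ _)) (interchange _ _ _ _)

antidiag-⊗ˡ : ∀ m c g → antidiag m (λ i j → c ⊗ g i j) ≃ c ⊗ antidiag m g
antidiag-⊗ˡ zero    c g = ≃-refl
antidiag-⊗ˡ (suc m) c g = ≃-trans (⊕-cong ≃-refl (antidiag-⊗ˡ m c _)) (≃-sym (distribˡ c _ _))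

antidiag-sucʳ : ∀ m g → antidiag (suc m) g ≃ antidiag m (λ i j → g i (suc j)) ⊕ g (suc m) 0
antidiag-sucʳ zero    g = ≃-refl
antidiag-sucʳ (suc m) g =
  ≃-trans (⊕-cong ≃-refl (antidiag-sucʳ m (λ i j → g (suc i) j))) (≃-sym (⊕-assoc _ _ _))

antidiag-dropʳ : ∀ k n g → (∀ i j → j < k → g i j ≃ lit 0) →
                 antidiag (k + n) g ≃ antidiag n (λ i j → g i (k + j))
antidiag-dropʳ zero    n g g≃0 = ≃-refl
antidiag-dropʳ (suc k) n g g≃0 = begin
  antidiag (suc (k + n)) g                                  ≈⟨ antidiag-sucʳ (k + n) g ⟩
  antidiag (k + n) (λ i j → g i (suc j)) ⊕ g (suc k + n) 0  ≈⟨ ⊕-cong ≃-refl (g≃0 _ 0 (s≤s z≤n)) ⟩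
  antidiag (k + n) (λ i j → g i (suc j)) ⊕ lit 0            ≈⟨ ⊕-identityʳ _ ⟩
  antidiag (k + n) (λ i j → g i (suc j))                    ≈⟨ antidiag-dropʳ k n _ (λ i j j<k → g≃0 i (suc j) (s≤s j<k)) ⟩
  antidiag n (λ i j → g i (suc k + j))                      ∎

antidiag-pascal : ∀ m (F : ℕ → ℕ → Expr) →
  antidiag (suc m) (λ i j → lit (binom i j) ⊗ F i j) ≃
  antidiag m (λ i j → lit (binom i j) ⊗ F (suc i) j) ⊕ antidiag m (λ i j → lit (binom i j) ⊗ F i (suc j))
antidiag-pascal m F = begin
  antidiag (suc m) (λ i j → lit (binom i j) ⊗ F i j)       ≈⟨ antidiag-cong (suc m) pascal ⟩
  antidiag (suc m) (λ i j → left i j ⊕ right i j)          ≈⟨ antidiag-⊕ (suc m) left right ⟩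
  antidiag (suc m) left ⊕ antidiag (suc m) right           ≈⟨ ⊕-cong (⊕-identityˡ _) (antidiag-sucʳ m right) ⟩
  antidiag m (λ i j → left (suc i) j) ⊕ (antidiag m (λ i j → right i (suc j)) ⊕ lit 0)
                                                           ≈⟨ ⊕-cong ≃-refl (⊕-identityʳ _) ⟩
  antidiag m (λ i j → left (suc i) j) ⊕ antidiag m (λ i j → right i (suc j)) ∎
  where
  left right : ℕ → ℕ → Expr
  left  zero    j       = lit 0
  left  (suc i) j       = lit (binom i j) ⊗ F (suc i) j
  right i       zero    = lit 0
  right i       (suc j) = lit (binom i j) ⊗ F i (suc j)

  pascal : ∀ i j → i + j ≡ suc m → lit (binom i j) ⊗ F i j ≃ left i j ⊕ right i j
  pascal zero    (suc j) _ = ≃-sym (⊕-identityˡ _)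
  pascal (suc i) zero    _ = ≃-trans (⊗-congʳ (reflexive (cong lit (≡.sym (binom-0ʳ i))))) (≃-sym (⊕-identityʳ _))
  pascal (suc i) (suc j) _ = ≃-trans (⊗-congʳ (lit-+ (binom i (suc j)) (binom (suc i) j))) (distribʳ _ _ _)

-- Leibniz rules

iter-suc : ∀ {X : Set} n (f : X → X) x → iter (suc n) f x ≡ iter n f (f x)
iter-suc zero    f x = ≡.refl
iter-suc (suc n) f x = cong f (iter-suc n f x)

∂ⁿ : ℕ → Expr → Expr
∂ⁿ n = iter n ∂

∂ⁿ-cong : ∀ n {x y} → x ≃ y → ∂ⁿ n x ≃ ∂ⁿ n y
∂ⁿ-cong zero    x≃y = x≃y
∂ⁿ-cong (suc n) x≃y = ∂-cong (∂ⁿ-cong n x≃y)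

∂ⁿ-lit-⊗ : ∀ n c x → ∂ⁿ n (lit c ⊗ x) ≃ lit c ⊗ ∂ⁿ n x
∂ⁿ-lit-⊗ zero    c x = ≃-refl
∂ⁿ-lit-⊗ (suc n) c x = begin
  ∂ (∂ⁿ n (lit c ⊗ x))                    ≈⟨ ∂-cong (∂ⁿ-lit-⊗ n c x) ⟩
  lit 0 ⊗ ∂ⁿ n x ⊕ lit c ⊗ ∂ (∂ⁿ n x)     ≈⟨ ⊕-cong (zeroˡ _) ≃-refl ⟩
  lit 0 ⊕ lit c ⊗ ∂ (∂ⁿ n x)              ≈⟨ ⊕-identityˡ _ ⟩
  lit c ⊗ ∂ (∂ⁿ n x)                      ∎

∂ⁿ-B : ∀ i j → ∂ⁿ i (B j) ≡ B (j + i)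
∂ⁿ-B zero    j = cong B (≡.sym (ℕ.+-identityʳ j))
∂ⁿ-B (suc i) j = ≡.trans (cong ∂ (∂ⁿ-B i j)) (cong B (≡.sym (ℕ.+-suc j i)))

infix  4 _≈ₜ_
infixl 6 _⊕ₜ_
infixr 7 _·ₜ_

_≈ₜ_ : TPoly → TPoly → Set₁
f ≈ₜ g = ∀ k → f k ≃ g k

_⊕ₜ_ : TPoly → TPoly → TPoly
(f ⊕ₜ g) k = f k ⊕ g k

_·ₜ_ : Expr → TPoly → TPoly
(x ·ₜ f) k = x ⊗ f k

t*_ : TPoly → TPoly
(t* f) zero    = lit 0
(t* f) (suc k) = f k

constₜ : Expr → TPoly
constₜ x zero    = x
constₜ x (suc k) = lit 0

stepⁿ : ℕ → TPoly → TPoly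
stepⁿ n = iter n step

step-cong : ∀ {f g} → f ≈ₜ g → step f ≈ₜ step g
step-cong f≈g zero    = ∂-cong (f≈g zero)
step-cong f≈g (suc k) = ⊕-cong (⊗-congˡ (f≈g k)) (∂-cong (f≈g (suc k)))

stepⁿ-cong : ∀ n {f g} → f ≈ₜ g → stepⁿ n f ≈ₜ stepⁿ n g
stepⁿ-cong zero    f≈g = f≈g
stepⁿ-cong (suc n) f≈g = step-cong (stepⁿ-cong n f≈g)

step-⊕ₜ : ∀ f g → step (f ⊕ₜ g) ≈ₜ step f ⊕ₜ step g
step-⊕ₜ f g zero    = ≃-refl
step-⊕ₜ f g (suc k) = ≃-trans (⊕-cong (distribˡ _ _ _) ≃-refl) (interchange _ _ _ _)

stepⁿ-⊕ₜ : ∀ n f g → stepⁿ n (f ⊕ₜ g) ≈ₜ stepⁿ n f ⊕ₜ stepⁿ n g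
stepⁿ-⊕ₜ zero    f g k = ≃-refl
stepⁿ-⊕ₜ (suc n) f g k = ≃-trans (step-cong (stepⁿ-⊕ₜ n f g) k) (step-⊕ₜ _ _ k)

step-Leibniz : ∀ x f → step (x ·ₜ f) ≈ₜ ∂ x ·ₜ f ⊕ₜ x ·ₜ step f
step-Leibniz x f zero    = ≃-refl
step-Leibniz x f (suc k) = solve 6 (λ b x fₖ ∂x fₖ₊₁ ∂fₖ₊₁ →
  b :* (x :* fₖ) :+ (∂x :* fₖ₊₁ :+ x :* ∂fₖ₊₁) := ∂x :* fₖ₊₁ :+ x :* (b :* fₖ :+ ∂fₖ₊₁))
  ≃-refl b₁ x (f k) (∂ x) (f (suc k)) (∂ (f (suc k)))

stepⁿ-Leibniz : ∀ m x f k →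
  stepⁿ m (x ·ₜ f) k ≃ antidiag m (λ i j → lit (binom i j) ⊗ (∂ⁿ i x ⊗ stepⁿ j f k))
stepⁿ-Leibniz zero    x f k = ≃-sym (⊗-identityˡ _)
stepⁿ-Leibniz (suc m) x f k = begin
  stepⁿ (suc m) (x ·ₜ f) k
    ≡⟨ cong (λ g → g k) (iter-suc m step (x ·ₜ f)) ⟩
  stepⁿ m (step (x ·ₜ f)) k
    ≈⟨ stepⁿ-cong m (step-Leibniz x f) k ⟩
  stepⁿ m (∂ x ·ₜ f ⊕ₜ x ·ₜ step f) k
    ≈⟨ stepⁿ-⊕ₜ m _ _ k ⟩
  stepⁿ m (∂ x ·ₜ f) k ⊕ stepⁿ m (x ·ₜ step f) k
    ≈⟨ ⊕-cong (stepⁿ-Leibniz m (∂ x) f k) (stepⁿ-Leibniz m x (step f) k) ⟩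
  antidiag m (λ i j → lit (binom i j) ⊗ (∂ⁿ i (∂ x) ⊗ stepⁿ j f k)) ⊕
  antidiag m (λ i j → lit (binom i j) ⊗ (∂ⁿ i x ⊗ stepⁿ j (step f) k))
    ≈⟨ ⊕-cong (antidiag-cong m λ i j _ → reflexive (cong (λ y → lit (binom i j) ⊗ (y ⊗ stepⁿ j f k)) (≡.sym (iter-suc i ∂ x))))
              (antidiag-cong m λ i j _ → reflexive (cong (λ g → lit (binom i j) ⊗ (∂ⁿ i x ⊗ g k)) (≡.sym (iter-suc j step f)))) ⟩
  antidiag m (λ i j → lit (binom i j) ⊗ (∂ⁿ (suc i) x ⊗ stepⁿ j f k)) ⊕
  antidiag m (λ i j → lit (binom i j) ⊗ (∂ⁿ i x ⊗ stepⁿ (suc j) f k))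
    ≈⟨ antidiag-pascal m (λ i j → ∂ⁿ i x ⊗ stepⁿ j f k) ⟨
  antidiag (suc m) (λ i j → lit (binom i j) ⊗ (∂ⁿ i x ⊗ stepⁿ j f k)) ∎

stepⁿ-at-0 : ∀ m f → stepⁿ m f 0 ≡ ∂ⁿ m (f 0)
stepⁿ-at-0 zero    f = ≡.refl
stepⁿ-at-0 (suc m) f = cong ∂ (stepⁿ-at-0 m f)

∂ⁿ-Leibniz : ∀ m x y → ∂ⁿ m (x ⊗ y) ≃ antidiag m (λ i j → lit (binom i j) ⊗ (∂ⁿ i x ⊗ ∂ⁿ j y))
∂ⁿ-Leibniz m x y = begin
  ∂ⁿ m (x ⊗ y)                 ≡⟨ stepⁿ-at-0 m (x ·ₜ constₜ y) ⟨
  stepⁿ m (x ·ₜ constₜ y) 0    ≈⟨ stepⁿ-Leibniz m x (constₜ y) 0 ⟩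
  antidiag m (λ i j → lit (binom i j) ⊗ (∂ⁿ i x ⊗ stepⁿ j (constₜ y) 0))
    ≈⟨ antidiag-cong m (λ i j _ → reflexive (cong (λ z → lit (binom i j) ⊗ (∂ⁿ i x ⊗ z)) (stepⁿ-at-0 j (constₜ y)))) ⟩
  antidiag m (λ i j → lit (binom i j) ⊗ (∂ⁿ i x ⊗ ∂ⁿ j y)) ∎

step-t* : ∀ f → step (t* f) ≈ₜ t* step f
step-t* f zero          = ≃-refl
step-t* f (suc zero)    = ≃-trans (⊕-cong (zeroʳ _) ≃-refl) (⊕-identityˡ _)
step-t* f (suc (suc k)) = ≃-refl

stepⁿ-t* : ∀ n f → stepⁿ n (t* f) ≈ₜ t* stepⁿ n f
stepⁿ-t* zero    f k = ≃-refl
stepⁿ-t* (suc n) f k = ≃-trans (step-cong (stepⁿ-t* n f) k) (step-t* _ k)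

∂-pow : ∀ x k → ∂ (pow x (suc k)) ≃ lit (suc k) ⊗ (∂ x ⊗ pow x k)
∂-pow x zero = begin
  lit 0 ⊗ x ⊕ lit 1 ⊗ ∂ x   ≈⟨ ⊕-cong (zeroˡ x) (⊗-identityˡ (∂ x)) ⟩
  lit 0 ⊕ ∂ x               ≈⟨ ⊕-identityˡ (∂ x) ⟩
  ∂ x                       ≈⟨ ≃-trans (⊗-identityˡ _) (⊗-identityʳ _) ⟨
  lit 1 ⊗ (∂ x ⊗ lit 1)     ∎
∂-pow x (suc k) = begin
  ∂ (pow x (suc k)) ⊗ x ⊕ pow x (suc k) ⊗ ∂ x
    ≈⟨ ⊕-cong (⊗-congʳ (∂-pow x k)) ≃-refl ⟩
  lit (suc k) ⊗ (∂ x ⊗ pow x k) ⊗ x ⊕ pow x k ⊗ x ⊗ ∂ x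
    ≈⟨ solve 4 (λ c d p x → c :* (d :* p) :* x :+ p :* x :* d := d :* (p :* x) :+ c :* (d :* (p :* x)))
               ≃-refl (lit (suc k)) (∂ x) (pow x k) x ⟩
  ∂ x ⊗ pow x (suc k) ⊕ lit (suc k) ⊗ (∂ x ⊗ pow x (suc k))
    ≈⟨ lit-suc-⊗ (suc k) _ ⟨
  lit (suc (suc k)) ⊗ (∂ x ⊗ pow x (suc k)) ∎

∂ⁿ-b₁⊗-Leibniz : ∀ m y → ∂ⁿ m (b₁ ⊗ y) ≃ antidiag m (λ i j → lit (binom i j) ⊗ (B i ⊗ ∂ⁿ j y))
∂ⁿ-b₁⊗-Leibniz m y = ≃-trans (∂ⁿ-Leibniz m b₁ y)
  (antidiag-cong m λ i j _ → reflexive (cong (λ z → lit (binom i j) ⊗ (z ⊗ ∂ⁿ j y)) (∂ⁿ-B i 0)))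

antidiag-index-weighted : ∀ n y →
  antidiag (suc n) (λ i j → lit i ⊗ (lit (binom i j) ⊗ (B i ⊗ ∂ⁿ j y))) ≃ lit (suc n) ⊗ ∂ⁿ n (B 1 ⊗ y)
antidiag-index-weighted n y = begin
  lit 0 ⊗ (lit 1 ⊗ (B 0 ⊗ ∂ⁿ (suc n) y)) ⊕ antidiag n (λ i j → lit (suc i) ⊗ (lit (binom (suc i) j) ⊗ (B (suc i) ⊗ ∂ⁿ j y)))
    ≈⟨ ⊕-cong (zeroˡ _) (antidiag-cong n λ i j i+j≡n → rescale _ (absorb i j i+j≡n)) ⟩
  lit 0 ⊕ antidiag n (λ i j → lit (suc n) ⊗ (lit (binom i j) ⊗ (B (suc i) ⊗ ∂ⁿ j y)))
    ≈⟨ ⊕-identityˡ _ ⟩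
  antidiag n (λ i j → lit (suc n) ⊗ (lit (binom i j) ⊗ (B (suc i) ⊗ ∂ⁿ j y)))
    ≈⟨ antidiag-⊗ˡ n _ _ ⟩
  lit (suc n) ⊗ antidiag n (λ i j → lit (binom i j) ⊗ (B (suc i) ⊗ ∂ⁿ j y))
    ≈⟨ ⊗-congˡ (antidiag-cong n λ i j _ → reflexive (cong (λ z → lit (binom i j) ⊗ (z ⊗ ∂ⁿ j y)) (∂ⁿ-B i 1))) ⟨
  lit (suc n) ⊗ antidiag n (λ i j → lit (binom i j) ⊗ (∂ⁿ i (B 1) ⊗ ∂ⁿ j y))
    ≈⟨ ⊗-congˡ (∂ⁿ-Leibniz n (B 1) y) ⟨
  lit (suc n) ⊗ ∂ⁿ n (B 1 ⊗ y) ∎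
  where
  absorb : ∀ i j → i + j ≡ n → suc i * binom (suc i) j ≡ suc n * binom i j
  absorb i j i+j≡n = ≡.trans (binom-absorbˡ i j) (cong (λ m → suc m * binom i j) i+j≡n)

-- Bell polynomials

Bell-0ʳ : ∀ r n → Bell r n 0 ≡ ∂ⁿ n (pow a₁ r)
Bell-0ʳ r n = stepⁿ-at-0 n (a₁^ r)

Bell-Leibniz : ∀ r m k → Bell r m k ≃ antidiag m (λ i j → lit (binom i j) ⊗ (∂ⁿ i (pow a₁ r) ⊗ Bell 0 j k))
Bell-Leibniz r m k = ≃-trans (stepⁿ-cong m a₁^≈ k) (stepⁿ-Leibniz m (pow a₁ r) (a₁^ 0) k)
  where
  a₁^≈ : a₁^ r ≈ₜ pow a₁ r ·ₜ a₁^ 0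
  a₁^≈ zero    = ≃-sym (≃-trans (⊗-comm _ _) (⊗-identityˡ _))
  a₁^≈ (suc k) = ≃-sym (zeroʳ _)

Bell-recurrence : ∀ m k → Bell 0 (suc m) (suc k) ≃ antidiag m (λ i j → lit (binom i j) ⊗ (B i ⊗ Bell 0 j k))
Bell-recurrence m k = begin
  Bell 0 (suc m) (suc k)                  ≡⟨ cong (λ g → g (suc k)) (iter-suc m step (a₁^ 0)) ⟩
  stepⁿ m (step (a₁^ 0)) (suc k)          ≈⟨ stepⁿ-cong m step-1ₜ (suc k) ⟩
  stepⁿ m (t* (b₁ ·ₜ a₁^ 0)) (suc k)      ≈⟨ stepⁿ-t* m _ (suc k) ⟩
  stepⁿ m (b₁ ·ₜ a₁^ 0) k                 ≈⟨ stepⁿ-Leibniz m b₁ (a₁^ 0) k ⟩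
  antidiag m (λ i j → lit (binom i j) ⊗ (∂ⁿ i b₁ ⊗ Bell 0 j k))
    ≈⟨ antidiag-cong m (λ i j _ → reflexive (cong (λ y → lit (binom i j) ⊗ (y ⊗ Bell 0 j k)) (∂ⁿ-B i 0))) ⟩
  antidiag m (λ i j → lit (binom i j) ⊗ (B i ⊗ Bell 0 j k)) ∎
  where
  step-1ₜ : step (a₁^ 0) ≈ₜ t* (b₁ ·ₜ a₁^ 0)
  step-1ₜ zero          = ≃-refl
  step-1ₜ (suc zero)    = ⊕-identityʳ _
  step-1ₜ (suc (suc k)) = ⊕-identityʳ _

Bell-vanishes : ∀ m k → m < k → Bell 0 m k ≃ lit 0
Bell-vanishes zero    (suc k) _         = ≃-refl
Bell-vanishes (suc m) (suc k) (s≤s m<k) = begin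
  b₁ ⊗ Bell 0 m k ⊕ ∂ (Bell 0 m (suc k))   ≈⟨ ⊕-cong (⊗-congˡ (Bell-vanishes m k m<k)) (∂-cong (Bell-vanishes m (suc k) (ℕ.m<n⇒m<1+n m<k))) ⟩
  b₁ ⊗ lit 0 ⊕ lit 0                       ≈⟨ ⊕-identityʳ _ ⟩
  b₁ ⊗ lit 0                               ≈⟨ zeroʳ _ ⟩
  lit 0                                    ∎

-- Substitutions

subst-∂ : ∀ {σ τ} → (∀ i → σ (suc i) ≡ ∂ (σ i)) → (∀ i → τ (suc i) ≡ ∂ (τ i)) →
          ∀ x → subst σ τ (∂ x) ≡ ∂ (subst σ τ x)
subst-∂ σ-∂ τ-∂ (A i)   = σ-∂ i
subst-∂ σ-∂ τ-∂ (B i)   = τ-∂ i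
subst-∂ σ-∂ τ-∂ (lit m) = ≡.refl
subst-∂ σ-∂ τ-∂ (x ⊕ y) = cong₂ _⊕_ (subst-∂ σ-∂ τ-∂ x) (subst-∂ σ-∂ τ-∂ y)
subst-∂ {σ} {τ} σ-∂ τ-∂ (x ⊗ y) =
  cong₂ _⊕_ (cong (_⊗ subst σ τ y) (subst-∂ σ-∂ τ-∂ x)) (cong (subst σ τ x ⊗_) (subst-∂ σ-∂ τ-∂ y))

subst-∂ⁿ : ∀ {σ τ} → (∀ i → σ (suc i) ≡ ∂ (σ i)) → (∀ i → τ (suc i) ≡ ∂ (τ i)) →
           ∀ n x → subst σ τ (∂ⁿ n x) ≡ ∂ⁿ n (subst σ τ x)
subst-∂ⁿ σ-∂ τ-∂ zero    x = ≡.refl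
subst-∂ⁿ σ-∂ τ-∂ (suc n) x = ≡.trans (subst-∂ σ-∂ τ-∂ (∂ⁿ n x)) (cong ∂ (subst-∂ⁿ σ-∂ τ-∂ n x))

subst-pow : ∀ σ τ x k → subst σ τ (pow x k) ≡ pow (subst σ τ x) k
subst-pow σ τ x zero    = ≡.refl
subst-pow σ τ x (suc k) = cong (_⊗ subst σ τ x) (subst-pow σ τ x k)

data BFree : Expr → Set where
  A   : ∀ i → BFree (A i)
  lit : ∀ m → BFree (lit m)
  _⊕_ : ∀ {x y} → BFree x → BFree y → BFree (x ⊕ y)
  _⊗_ : ∀ {x y} → BFree x → BFree y → BFree (x ⊗ y)

BFree-∂ : ∀ {x} → BFree x → BFree (∂ x)
BFree-∂ (A i)   = A (suc i)
BFree-∂ (lit m) = lit 0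
BFree-∂ (p ⊕ q) = BFree-∂ p ⊕ BFree-∂ q
BFree-∂ (p ⊗ q) = BFree-∂ p ⊗ q ⊕ p ⊗ BFree-∂ q

BFree-∂ⁿ : ∀ n {x} → BFree x → BFree (∂ⁿ n x)
BFree-∂ⁿ zero    p = p
BFree-∂ⁿ (suc n) p = BFree-∂ (BFree-∂ⁿ n p)

BFree-pow-a₁ : ∀ r → BFree (pow a₁ r)
BFree-pow-a₁ zero    = lit 1
BFree-pow-a₁ (suc r) = BFree-pow-a₁ r ⊗ A 0

subst-BFree : ∀ τ {x} → BFree x → subst aVar τ x ≡ x
subst-BFree τ (A i)   = ≡.refl
subst-BFree τ (lit m) = ≡.refl
subst-BFree τ (p ⊕ q) = cong₂ _⊕_ (subst-BFree τ p) (subst-BFree τ q)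
subst-BFree τ (p ⊗ q) = cong₂ _⊗_ (subst-BFree τ p) (subst-BFree τ q)

subst-antidiag : ∀ σ τ m g → subst σ τ (antidiag m g) ≡ antidiag m (λ i j → subst σ τ (g i j))
subst-antidiag σ τ zero    g = ≡.refl
subst-antidiag σ τ (suc m) g = cong (subst σ τ (g 0 (suc m)) ⊕_) (subst-antidiag σ τ m (λ i j → g (suc i) j))

weightB : Expr → Expr
weightB = subst aVar jbVar

-- Parametrised by weightB-Bell at k, so that it also serves the inductive step of weightB-Bell.
antidiag-weightB-Bell : ∀ k → (∀ j → weightB (Bell 0 (k + j) k) ≃ lit (binom j k) ⊗ ∂ⁿ j (pow b₁ k)) →
  ∀ n (X : ℕ → Expr) →
  antidiag (k + n) (λ i j → lit (binom i j) ⊗ (X i ⊗ weightB (Bell 0 j k)))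
  ≃ lit (binom n k) ⊗ antidiag n (λ i j → lit (binom i j) ⊗ (X i ⊗ ∂ⁿ j (pow b₁ k)))
antidiag-weightB-Bell k weightB-Bellₖ n X = begin
  antidiag (k + n) (λ i j → lit (binom i j) ⊗ (X i ⊗ weightB (Bell 0 j k)))
    ≈⟨ antidiag-dropʳ k n _ vanish ⟩
  antidiag n (λ i j → lit (binom i (k + j)) ⊗ (X i ⊗ weightB (Bell 0 (k + j) k)))
    ≈⟨ antidiag-cong n term ⟩
  antidiag n (λ i j → lit (binom n k) ⊗ (lit (binom i j) ⊗ (X i ⊗ ∂ⁿ j (pow b₁ k))))
    ≈⟨ antidiag-⊗ˡ n _ _ ⟩
  lit (binom n k) ⊗ antidiag n (λ i j → lit (binom i j) ⊗ (X i ⊗ ∂ⁿ j (pow b₁ k))) ∎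
  where
  vanish : ∀ i j → j < k → lit (binom i j) ⊗ (X i ⊗ weightB (Bell 0 j k)) ≃ lit 0
  vanish i j j<k = ≃-trans (⊗-congˡ (≃-trans (⊗-congˡ (subst-cong aVar jbVar (Bell-vanishes j k j<k))) (zeroʳ _)))
                           (zeroʳ _)

  term : ∀ i j → i + j ≡ n → lit (binom i (k + j)) ⊗ (X i ⊗ weightB (Bell 0 (k + j) k))
                              ≃ lit (binom n k) ⊗ (lit (binom i j) ⊗ (X i ⊗ ∂ⁿ j (pow b₁ k)))
  term i j i+j≡n = begin
    lit (binom i (k + j)) ⊗ (X i ⊗ weightB (Bell 0 (k + j) k))
      ≈⟨ ⊗-congˡ (⊗-congˡ (weightB-Bellₖ j)) ⟩
    lit (binom i (k + j)) ⊗ (X i ⊗ (lit (binom j k) ⊗ ∂ⁿ j (pow b₁ k)))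
      ≈⟨ solve 4 (λ c d x y → c :* (x :* (d :* y)) := c :* (d :* (x :* y))) ≃-refl _ _ _ _ ⟩
    lit (binom i (k + j)) ⊗ (lit (binom j k) ⊗ (X i ⊗ ∂ⁿ j (pow b₁ k)))
      ≈⟨ rescale _ coefficients ⟩
    lit (binom n k) ⊗ (lit (binom i j) ⊗ (X i ⊗ ∂ⁿ j (pow b₁ k))) ∎
    where
    coefficients : binom i (k + j) * binom j k ≡ binom n k * binom i j
    coefficients = ≡.trans (cong (λ m → binom i m * binom j k) (ℕ.+-comm k j))
                     (≡.trans (binom-trinomial i j k) (cong (λ m → binom m k * binom i j) i+j≡n))

∂ⁿ-pow-b₁-weighted : ∀ n k →
  lit (binom n k) ⊗ antidiag n (λ i j → lit (binom i j) ⊗ (jbVar i ⊗ ∂ⁿ j (pow b₁ k)))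
  ≃ lit (binom n (suc k)) ⊗ ∂ⁿ n (pow b₁ (suc k))
∂ⁿ-pow-b₁-weighted n k = begin
  lit (binom n k) ⊗ antidiag n (λ i j → lit (binom i j) ⊗ (jbVar i ⊗ ∂ⁿ j (pow b₁ k)))
    ≈⟨ ⊗-congˡ (antidiag-cong n λ i j _ → split i (binom i j) (∂ⁿ j (pow b₁ k))) ⟩
  lit (binom n k) ⊗ antidiag n (λ i j → unweighted i j ⊕ lit i ⊗ unweighted i j)
    ≈⟨ ⊗-congˡ (antidiag-⊕ n _ _) ⟩
  lit (binom n k) ⊗ (antidiag n unweighted ⊕ antidiag n (λ i j → lit i ⊗ unweighted i j))
    ≈⟨ ⊗-congˡ (⊕-cong (≃-sym (≃-trans (∂ⁿ-cong n (⊗-comm _ _)) (∂ⁿ-b₁⊗-Leibniz n (pow b₁ k)))) ≃-refl) ⟩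
  lit (binom n k) ⊗ (∂ⁿ n (pow b₁ (suc k)) ⊕ antidiag n (λ i j → lit i ⊗ unweighted i j))
    ≈⟨ absorb n ⟩
  lit (binom n (suc k)) ⊗ ∂ⁿ n (pow b₁ (suc k)) ∎
  where
  unweighted : ℕ → ℕ → Expr
  unweighted i j = lit (binom i j) ⊗ (B i ⊗ ∂ⁿ j (pow b₁ k))

  split : ∀ i c z → lit c ⊗ (jbVar i ⊗ z) ≃ lit c ⊗ (B i ⊗ z) ⊕ lit i ⊗ (lit c ⊗ (B i ⊗ z))
  split i c z = ≃-trans (⊗-congˡ (⊗-congʳ (lit-suc-⊗ i (B i))))
    (solve 4 (λ c b m z → c :* ((b :+ m :* b) :* z) := c :* (b :* z) :+ m :* (c :* (b :* z)))
           ≃-refl (lit c) (B i) (lit i) z)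

  absorb : ∀ m → lit (binom m k) ⊗ (∂ⁿ m (pow b₁ (suc k)) ⊕ antidiag m (λ i j → lit i ⊗ unweighted i j))
                 ≃ lit (binom m (suc k)) ⊗ ∂ⁿ m (pow b₁ (suc k))
  absorb zero = ⊗-congˡ (≃-trans (⊕-cong ≃-refl (zeroˡ _)) (⊕-identityʳ _))
  absorb (suc m) = begin
    lit (binom (suc m) k) ⊗ (∂ⁿ (suc m) (pow b₁ (suc k)) ⊕ antidiag (suc m) (λ i j → lit i ⊗ unweighted i j))
      ≈⟨ ⊗-congˡ (⊕-cong ∂ⁿ⁺¹-pow (antidiag-index-weighted m (pow b₁ k))) ⟩
    lit (binom (suc m) k) ⊗ (lit (suc k) ⊗ E ⊕ lit (suc m) ⊗ E)
      ≈⟨ ⊗-congˡ (≃-trans (≃-sym (distribʳ E _ _)) (⊗-congʳ (≃-sym (lit-+ (suc k) (suc m))))) ⟩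
    lit (binom (suc m) k) ⊗ (lit (suc k + suc m) ⊗ E)
      ≈⟨ rescale E coefficients ⟩
    lit (binom (suc m) (suc k)) ⊗ (lit (suc k) ⊗ E)
      ≈⟨ ⊗-congˡ ∂ⁿ⁺¹-pow ⟨
    lit (binom (suc m) (suc k)) ⊗ ∂ⁿ (suc m) (pow b₁ (suc k)) ∎
    where
    E : Expr
    E = ∂ⁿ m (B 1 ⊗ pow b₁ k)

    ∂ⁿ⁺¹-pow : ∂ⁿ (suc m) (pow b₁ (suc k)) ≃ lit (suc k) ⊗ E
    ∂ⁿ⁺¹-pow = begin
      ∂ⁿ (suc m) (pow b₁ (suc k))            ≡⟨ iter-suc m ∂ (pow b₁ (suc k)) ⟩
      ∂ⁿ m (∂ (pow b₁ (suc k)))              ≈⟨ ∂ⁿ-cong m (∂-pow b₁ k) ⟩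
      ∂ⁿ m (lit (suc k) ⊗ (B 1 ⊗ pow b₁ k))  ≈⟨ ∂ⁿ-lit-⊗ m (suc k) _ ⟩
      lit (suc k) ⊗ E                        ∎

    coefficients : binom (suc m) k * (suc k + suc m) ≡ binom (suc m) (suc k) * suc k
    coefficients =
      ≡.trans (ℕ.*-comm (binom (suc m) k) (suc k + suc m))
        (≡.trans (cong (λ x → suc x * binom (suc m) k) (ℕ.+-comm k (suc m)))
          (≡.trans (≡.sym (binom-absorbʳ (suc m) k)) (ℕ.*-comm (suc k) (binom (suc m) (suc k)))))

weightB-Bell : ∀ k n → weightB (Bell 0 (k + n) k) ≃ lit (binom n k) ⊗ ∂ⁿ n (pow b₁ k)
weightB-Bell zero n = begin
  weightB (Bell 0 n 0)                ≡⟨ cong weightB (Bell-0ʳ 0 n) ⟩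
  weightB (∂ⁿ n (lit 1))              ≡⟨ subst-BFree jbVar (BFree-∂ⁿ n (lit 1)) ⟩
  ∂ⁿ n (lit 1)                        ≈⟨ ⊗-identityˡ _ ⟨
  lit 1 ⊗ ∂ⁿ n (lit 1)                ≡⟨ cong (λ c → lit c ⊗ ∂ⁿ n (lit 1)) (binom-0ʳ n) ⟨
  lit (binom n 0) ⊗ ∂ⁿ n (pow b₁ 0)   ∎
weightB-Bell (suc k) n = begin
  weightB (Bell 0 (suc (k + n)) (suc k))
    ≈⟨ subst-cong aVar jbVar (Bell-recurrence (k + n) k) ⟩
  weightB (antidiag (k + n) (λ i j → lit (binom i j) ⊗ (B i ⊗ Bell 0 j k)))
    ≡⟨ subst-antidiag aVar jbVar (k + n) _ ⟩
  antidiag (k + n) (λ i j → lit (binom i j) ⊗ (jbVar i ⊗ weightB (Bell 0 j k)))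
    ≈⟨ antidiag-weightB-Bell k (weightB-Bell k) n jbVar ⟩
  lit (binom n k) ⊗ antidiag n (λ i j → lit (binom i j) ⊗ (jbVar i ⊗ ∂ⁿ j (pow b₁ k)))
    ≈⟨ ∂ⁿ-pow-b₁-weighted n k ⟩
  lit (binom n (suc k)) ⊗ ∂ⁿ n (pow b₁ (suc k)) ∎

binom-B̃ : ∀ n k r → lit ((n + k) C n) ⊗ B̃ r n k ≃ weightB (Bell r (n + k) k)
binom-B̃ n k r = begin
  lit ((n + k) C n) ⊗ B̃ r n k
    ≡⟨ cong (λ c → lit c ⊗ B̃ r n k) (binom≡C n k) ⟨
  lit (binom n k) ⊗ B̃ r n k
    ≈⟨ ⊗-congˡ (∂ⁿ-Leibniz n (pow a₁ r) (pow b₁ k)) ⟩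
  lit (binom n k) ⊗ antidiag n (λ i j → lit (binom i j) ⊗ (∂ⁿ i (pow a₁ r) ⊗ ∂ⁿ j (pow b₁ k)))
    ≈⟨ ⊗-congˡ (antidiag-cong n λ i j _ → reflexive (cong (λ x → lit (binom i j) ⊗ (x ⊗ ∂ⁿ j (pow b₁ k)))
                                                          (≡.sym (weightB-fixes-a i)))) ⟩
  lit (binom n k) ⊗ antidiag n (λ i j → lit (binom i j) ⊗ (weightB (∂ⁿ i (pow a₁ r)) ⊗ ∂ⁿ j (pow b₁ k)))
    ≈⟨ antidiag-weightB-Bell k (weightB-Bell k) n (λ i → weightB (∂ⁿ i (pow a₁ r))) ⟨
  antidiag (k + n) (λ i j → lit (binom i j) ⊗ (weightB (∂ⁿ i (pow a₁ r)) ⊗ weightB (Bell 0 j k)))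
    ≡⟨ subst-antidiag aVar jbVar (k + n) _ ⟨
  weightB (antidiag (k + n) (λ i j → lit (binom i j) ⊗ (∂ⁿ i (pow a₁ r) ⊗ Bell 0 j k)))
    ≈⟨ subst-cong aVar jbVar (Bell-Leibniz r (k + n) k) ⟨
  weightB (Bell r (k + n) k)
    ≡⟨ cong (λ m → weightB (Bell r m k)) (ℕ.+-comm k n) ⟩
  weightB (Bell r (n + k) k) ∎
  where
  weightB-fixes-a : ∀ i → weightB (∂ⁿ i (pow a₁ r)) ≡ ∂ⁿ i (pow a₁ r)
  weightB-fixes-a i = subst-BFree jbVar (BFree-∂ⁿ i (BFree-pow-a₁ r))

B̃-constant-coefficient : ∀ n k → B̃ 0 n k ≃ subst bVar bVar (Bell k n 0)
B̃-constant-coefficient n k = begin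
  ∂ⁿ n (lit 1 ⊗ pow b₁ k)              ≈⟨ ∂ⁿ-cong n (⊗-identityˡ _) ⟩
  ∂ⁿ n (pow b₁ k)                      ≡⟨ cong (∂ⁿ n) (subst-pow bVar bVar a₁ k) ⟨
  ∂ⁿ n (subst bVar bVar (pow a₁ k))    ≡⟨ subst-∂ⁿ (λ _ → ≡.refl) (λ _ → ≡.refl) n (pow a₁ k) ⟨
  subst bVar bVar (∂ⁿ n (pow a₁ k))    ≡⟨ cong (subst bVar bVar) (Bell-0ʳ k n) ⟨
  subst bVar bVar (Bell k n 0)         ∎

mainTheorem3 : ((n k r : ℕ) →
    lit ((n + k) C n) ⊗ B̃ r n k ≐ subst aVar jbVar (Bell r (n + k) k))
    × ((n k : ℕ) →
    (B̃ 0 n k ≐ subst bVar bVar (Bell k n 0))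
    × (lit ((n + k) C n) ⊗ B̃ 0 n k ≐ subst aVar jbVar (Bell 0 (n + k) k)))
mainTheorem3 = (λ n k r → run (binom-B̃ n k r))
             , (λ n k → run (B̃-constant-coefficient n k) , run (binom-B̃ n k 0))
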